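{- Let $\Gamma$ be a relator for the monad $T$ which is inductive and respects $\Sigma$, and let $\precsim_\Gamma=(\precsim_{\mathcal T},\precsim_{\mathcal V})$ be applicative $\Gamma$-similarity. Then (the open extension of) applicative $\Gamma$-similarity is a precongruence, i.e. a compatible preorder on open terms and values. Moreover, it is sound for the $\Gamma$-contextual preorder: $\precsim_\Gamma \subseteq \leq_\Gamma$.
   Context: A signature $\Sigma$ is a set of operation symbols $\sigma$, each with a finite arity $\alpha(\sigma)$. An $\omega$CPPO is a poset with a least element $\bot$ in which every $\omega$-chain has a least upper bound (lub); a map between $\omega$CPPOs is continuous if it is monotone and preserves lubs of $\omega$-chains. Fix $\Sigma$ and a monad $T$ on sets (unit $\eta$, bind $u \gg\!= f$) carrying a continuous $\Sigma$-algebra structure: for every set $X$, $TX$ is an $\omega$CPPO $(TX,\sqsubseteq_X,\bot_X)$, bind is continuous in both arguments (in the second w.r.t. the pointwise order on $X\to TY$), and each $\sigma\in\Sigma$ of arity $k$ is interpreted by a continuous map $\sigma^T:(TX)^k\to TX$. Terms and values: $M,N ::= \mathsf{return}\,V \mid VW \mid M\ \mathsf{to}\ x.N \mid \sigma(M_1,\dots,M_k)$, $V,W ::= x \mid \lambda x.M$ (in $M\ \mathsf{to}\ x.N$, $x$ is bound in $N$), up to $\alpha$-equivalence; $\mathcal T_0,\mathcal V_0$ are the closed terms and closed values; $M[V/x]$ is capture-avoiding substitution. Judgments $M\Downarrow_n X$ ($M\in\mathcal T_0$, $X\in T\mathcal V_0$, $n\in\mathbb N$) are inductively defined by: $M\Downarrow_0\bot$;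 $\mathsf{return}\,V\Downarrow_{n+1}\eta(V)$; if $M[V/x]\Downarrow_n X$ then $(\lambda x.M)V\Downarrow_{n+1}X$; if $M\Downarrow_n X$ and $N[V/x]\Downarrow_n Y_V$ for every closed value $V$, then $(M\ \mathsf{to}\ x.N)\Downarrow_{n+1} X\gg\!=(V\mapsto Y_V)$; if $M_i\Downarrow_n X_i$ for $i=1..k$ then $\sigma(M_1,\dots,M_k)\Downarrow_{n+1}\sigma^T(X_1,\dots,X_k)$. For each $M$ the values $X_n$ with $M\Downarrow_n X_n$ are unique and form an $\omega$-chain; $[\![M]\!]=\bigsqcup_n X_n$. A relator $\Gamma$ for $T$ assigns to each relation $R\subseteq X\times Y$ a relation $\Gamma R\subseteq TX\times TY$ such that: $=_{TX}\subseteq\Gamma(=_X)$; $\Gamma S\circ\Gamma R\subseteq\Gamma(S\circ R)$; $\Gamma((f\times g)^{ -1}R)=(Tf\times Tg)^{ -1}\Gamma R$ where $(f\times g)^{ -1}R=\{(z,w)\mid f(z)\,R\,g(w)\}$; $R\subseteq S\Rightarrow\Gamma R\subseteq\Gamma S$; $x\,R\,y\Rightarrow\eta(x)\,\Gamma R\,\eta(y)$; and whenever $f:X\to TX'$, $g:Y\to TY'$, $S\subseteq X'\times Y'$ satisfy $x\,R\,y\Rightarrow f(x)\,\Gamma S\,g(y)$, then $u\,\Gamma R\,v\Rightarrow (u\gg\!=f)\,\Gamma S\,(v\gg\!=g)$. $\Gamma$ is inductive if for all $R$: $\bot\,\Gamma R\,v$ for all $v$, and for every $\omega$-chain $(u_n)$,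 $(\forall n.\ u_n\,\Gamma R\,v)\Rightarrow\bigsqcup_n u_n\,\Gamma R\,v$. $\Gamma$ respects $\Sigma$ if $u_i\,\Gamma R\,v_i$ for all $i$ implies $\sigma^T(u_1,\dots,u_k)\,\Gamma R\,\sigma^T(v_1,\dots,v_k)$. A closed relation $(R_{\mathcal T},R_{\mathcal V})$ with $R_{\mathcal T}\subseteq\mathcal T_0^2$, $R_{\mathcal V}\subseteq\mathcal V_0^2$ is an applicative $\Gamma$-simulation if $M\,R_{\mathcal T}\,N\Rightarrow[\![M]\!]\,\Gamma R_{\mathcal V}\,[\![N]\!]$ and $V\,R_{\mathcal V}\,W\Rightarrow VU\,R_{\mathcal T}\,WU$ for all closed values $U$; applicative $\Gamma$-similarity is the largest one. An open relation over terms is a set of triples $(\bar x,M,N)$ (written $\bar x\vdash M\,R\,N$) with the free variables of $M,N$ in the finite set $\bar x$; similarly over values; a $\lambda$-term relation is a pair of such. The open extension $R^\circ$ of a closed relation: $\bar x\vdash M\,R^\circ\,N$ iff $M[\bar V/\bar x]\,R\,N[\bar V/\bar x]$ for all closed values $\bar V$. A $\lambda$-term relation is compatible if: $\bar x\vdash x\,R\,x$ for $x\in\bar x$; $\bar x\cup\{x\}\vdash M\,R\,N\Rightarrow\bar x\vdash\lambda x.M\,R\,\lambda x.N$; $\bar x\vdash V\,R\,W\Rightarrow\bar x\vdash\mathsf{return}\,V\,R\,\mathsf{return}\,W$; $\bar x\vdash V\,R\,V'$, $\bar x\vdash W\,R\,W'\Rightarrow\bar x\vdash VW\,R\,V'W'$;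 $\bar x\vdash M\,R\,M'$, $\bar x\cup\{x\}\vdash N\,R\,N'\Rightarrow\bar x\vdash M\ \mathsf{to}\ x.N\,R\,M'\ \mathsf{to}\ x.N'$; $\bar x\vdash M_i\,R\,N_i$ for all $i\Rightarrow\bar x\vdash\sigma(\bar M)\,R\,\sigma(\bar N)$. A precongruence is a compatible preorder. A $\lambda$-term relation is preadequate if $\emptyset\vdash M\,R\,N$ (closed terms) implies $[\![M]\!]\,\Gamma\mathcal U\,[\![N]\!]$, where $\mathcal U=\mathcal V_0\times\mathcal V_0$. The $\Gamma$-contextual preorder $\leq_\Gamma$ is the union of all compatible preadequate $\lambda$-term relations. -}

module Defs where

open import Level using (Level; 0ℓ) renaming (suc to lsuc; _⊔_ to _⊔ℓ_)
open import Data.Nat using (ℕ; zero; suc)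
open import Data.Fin using (Fin; zero; suc)
open import Data.Product using (Σ; ∃; _×_; _,_; proj₁; proj₂)
open import Data.Unit using (⊤)
open import Relation.Binary.PropositionalEquality using (_≡_; refl)

record Signature : Set₁ where
  field
    Op : Set
    ar : Op → ℕ
open Signature public

record ωCPPO (A : Set) : Set₁ where
  field
    _⊑_      : A → A → Set
    ⊑-refl   : ∀ {x} → x ⊑ x
    ⊑-trans  : ∀ {x y z} → x ⊑ y → y ⊑ z → x ⊑ z
    ⊑-antisym : ∀ {x y} → x ⊑ y → y ⊑ x → x ≡ y
    bot      : A
    bot-least : ∀ {x} → bot ⊑ x
    ⨆        : (c : ℕ → A) → (∀ n → c n ⊑ c (suc n)) → A
    ⨆-ub     : ∀ c p n → c n ⊑ ⨆ c p
    ⨆-least  : ∀ c p {x} → (∀ n → c n ⊑ x) → ⨆ c p ⊑ x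

record ContAlg (Sig : Signature) : Set₁ where
  field
    T     : Set → Set
    η     : ∀ {X} → X → T X
    _>>=_ : ∀ {X Y} → T X → (X → T Y) → T Y
    >>=-unitˡ : ∀ {X Y} (x : X) (f : X → T Y) → (η x >>= f) ≡ f x
    >>=-unitʳ : ∀ {X} (u : T X) → (u >>= η) ≡ u
    >>=-assoc : ∀ {X Y Z} (u : T X) (f : X → T Y) (g : Y → T Z) →
                ((u >>= f) >>= g) ≡ (u >>= (λ x → f x >>= g))
    cppo : ∀ X → ωCPPO (T X)
    >>=-mono₁ : ∀ {X Y} {u u' : T X} (f : X → T Y) →
                ωCPPO._⊑_ (cppo X) u u' → ωCPPO._⊑_ (cppo Y) (u >>= f) (u' >>= f)
    >>=-lub₁  : ∀ {X Y} (c : ℕ → T X) (p : ∀ n → ωCPPO._⊑_ (cppo X) (c n) (c (suc n)))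
                (f : X → T Y) (w : T Y) →
                (∀ n → ωCPPO._⊑_ (cppo Y) (c n >>= f) w) →
                ωCPPO._⊑_ (cppo Y) (ωCPPO.⨆ (cppo X) c p >>= f) w
    >>=-mono₂ : ∀ {X Y} (u : T X) {f g : X → T Y} →
                (∀ x → ωCPPO._⊑_ (cppo Y) (f x) (g x)) →
                ωCPPO._⊑_ (cppo Y) (u >>= f) (u >>= g)
    >>=-lub₂  : ∀ {X Y} (u : T X) (c : ℕ → X → T Y)
                (p : ∀ n x → ωCPPO._⊑_ (cppo Y) (c n x) (c (suc n) x)) (w : T Y) →
                (∀ n → ωCPPO._⊑_ (cppo Y) (u >>= c n) w) →
                ωCPPO._⊑_ (cppo Y) (u >>= (λ x → ωCPPO.⨆ (cppo Y) (λ n → c n x) (λ n → p n x))) w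
    opT     : ∀ {X} (σ : Op Sig) → (Fin (ar Sig σ) → T X) → T X
    opT-mono : ∀ {X} (σ : Op Sig) {us vs : Fin (ar Sig σ) → T X} →
               (∀ i → ωCPPO._⊑_ (cppo X) (us i) (vs i)) →
               ωCPPO._⊑_ (cppo X) (opT σ us) (opT σ vs)
    opT-lub : ∀ {X} (σ : Op Sig) (c : ℕ → Fin (ar Sig σ) → T X)
              (p : ∀ n i → ωCPPO._⊑_ (cppo X) (c n i) (c (suc n) i)) (w : T X) →
              (∀ n → ωCPPO._⊑_ (cppo X) (opT σ (c n)) w) →
              ωCPPO._⊑_ (cppo X) (opT σ (λ i → ωCPPO.⨆ (cppo X) (λ n → c n i) (λ n → p n i))) w

  Tmap : ∀ {X Y} → (X → Y) → T X → T Y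
  Tmap f u = u >>= (λ x → η (f x))

-- Syntax (scoped de Bruijn: Tm n / Val n have free variables among Fin n)

module Syntax (Sig : Signature) where

  mutual
    data Val (n : ℕ) : Set where
      var : Fin n → Val n
      lam : Tm (suc n) → Val n

    data Tm (n : ℕ) : Set where
      ret : Val n → Tm n
      app : Val n → Val n → Tm n
      to  : Tm n → Tm (suc n) → Tm n
      op  : (σ : Op Sig) → (Fin (ar Sig σ) → Tm n) → Tm n

  Ren : ℕ → ℕ → Set
  Ren m n = Fin m → Fin n

  extR : ∀ {m n} → Ren m n → Ren (suc m) (suc n)
  extR ρ zero = zero
  extR ρ (suc i) = suc (ρ i)

  mutual
    renV : ∀ {m n} → Ren m n → Val m → Val n
    renV ρ (var i) = var (ρ i)
    renV ρ (lam M) = lam (renT (extR ρ) M)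

    renT : ∀ {m n} → Ren m n → Tm m → Tm n
    renT ρ (ret V) = ret (renV ρ V)
    renT ρ (app V W) = app (renV ρ V) (renV ρ W)
    renT ρ (to M N) = to (renT ρ M) (renT (extR ρ) N)
    renT ρ (op σ Ms) = op σ (λ i → renT ρ (Ms i))

  Sub : ℕ → ℕ → Set
  Sub m n = Fin m → Val n

  extS : ∀ {m n} → Sub m n → Sub (suc m) (suc n)
  extS s zero = var zero
  extS s (suc i) = renV suc (s i)

  mutual
    subV : ∀ {m n} → Sub m n → Val m → Val n
    subV s (var i) = s i
    subV s (lam M) = lam (subT (extS s) M)

    subT : ∀ {m n} → Sub m n → Tm m → Tm n
    subT s (ret V) = ret (subV s V)
    subT s (app V W) = app (subV s V) (subV s W)
    subT s (to M N) = to (subT s M) (subT (extS s) N)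
    subT s (op σ Ms) = op σ (λ i → subT s (Ms i))

  _[_] : ∀ {n} → Tm (suc n) → Val n → Tm n
  M [ V ] = subT (λ { zero → V ; (suc i) → var i }) M

  record LamRel (ℓ : Level) : Set (lsuc ℓ) where
    field
      RT : (n : ℕ) → Tm n → Tm n → Set ℓ
      RV : (n : ℕ) → Val n → Val n → Set ℓ
  open LamRel public

  record Compatible {ℓ} (R : LamRel ℓ) : Set ℓ where
    field
      c-var : ∀ n (i : Fin n) → RV R n (var i) (var i)
      c-lam : ∀ n M N → RT R (suc n) M N → RV R n (lam M) (lam N)
      c-ret : ∀ n V W → RV R n V W → RT R n (ret V) (ret W)
      c-app : ∀ n V V' W W' → RV R n V V' → RV R n W W' → RT R n (app V W) (app V' W')
      c-to  : ∀ n M M' N N' → RT R n M M' → RT R (suc n) N N' → RT R n (to M N) (to M' N')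
      c-op  : ∀ n σ (Ms Ns : Fin (ar Sig σ) → Tm n) →
              (∀ i → RT R n (Ms i) (Ns i)) → RT R n (op σ Ms) (op σ Ns)

  record Preorder {ℓ} (R : LamRel ℓ) : Set ℓ where
    field
      reflT  : ∀ n (M : Tm n) → RT R n M M
      reflV  : ∀ n (V : Val n) → RV R n V V
      transT : ∀ n (M N P : Tm n) → RT R n M N → RT R n N P → RT R n M P
      transV : ∀ n (U V W : Val n) → RV R n U V → RV R n V W → RV R n U W

  Precongruence : ∀ {ℓ} → LamRel ℓ → Set ℓ
  Precongruence R = Compatible R × Preorder R

  record ClosedRel (ℓ : Level) : Set (lsuc ℓ) where
    field
      CT : Tm 0 → Tm 0 → Set ℓ
      CV : Val 0 → Val 0 → Set ℓ
  open ClosedRel public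

  OpenExt : ∀ {ℓ} → ClosedRel ℓ → LamRel ℓ
  OpenExt R = record
    { RT = λ n M N → (s : Sub n 0) → CT R (subT s M) (subT s N)
    ; RV = λ n V W → (s : Sub n 0) → CV R (subV s V) (subV s W) }

module Semantics {Sig : Signature} (A : ContAlg Sig) where
  open Syntax Sig
  open ContAlg A

  private
    module C (X : Set) = ωCPPO (cppo X)

  _⊑_ : ∀ {X} → T X → T X → Set
  _⊑_ {X} = C._⊑_ X

  data _⇓[_]_ : Tm 0 → ℕ → T (Val 0) → Set where
    ⇓-zero : ∀ {M} → M ⇓[ 0 ] C.bot (Val 0)
    ⇓-ret  : ∀ {n V} → ret V ⇓[ suc n ] η V
    ⇓-app  : ∀ {n M V X} → (M [ V ]) ⇓[ n ] X → app (lam M) V ⇓[ suc n ] X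
    ⇓-to   : ∀ {n M N X} {Y : Val 0 → T (Val 0)} → M ⇓[ n ] X →
             (∀ V → (N [ V ]) ⇓[ n ] Y V) → to M N ⇓[ suc n ] (X >>= Y)
    ⇓-op   : ∀ {n σ Ms} {Xs : Fin (ar Sig σ) → T (Val 0)} →
             (∀ i → Ms i ⇓[ n ] Xs i) → op σ Ms ⇓[ suc n ] opT σ Xs

  eval : ℕ → Tm 0 → T (Val 0)
  eval zero M = C.bot (Val 0)
  eval (suc n) (ret V) = η V
  eval (suc n) (app (lam M) V) = eval n (M [ V ])
  eval (suc n) (to M N) = eval n M >>= (λ V → eval n (N [ V ]))
  eval (suc n) (op σ Ms) = opT σ (λ i → eval n (Ms i))

  eval-⇓ : ∀ n M → M ⇓[ n ] eval n M
  eval-⇓ zero M = ⇓-zero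
  eval-⇓ (suc n) (ret V) = ⇓-ret
  eval-⇓ (suc n) (app (lam M) V) = ⇓-app (eval-⇓ n (M [ V ]))
  eval-⇓ (suc n) (to M N) = ⇓-to (eval-⇓ n M) (λ V → eval-⇓ n (N [ V ]))
  eval-⇓ (suc n) (op σ Ms) = ⇓-op (λ i → eval-⇓ n (Ms i))

  eval-chain : ∀ n M → eval n M ⊑ eval (suc n) M
  eval-chain zero M = C.bot-least (Val 0)
  eval-chain (suc n) (ret V) = C.⊑-refl (Val 0)
  eval-chain (suc n) (app (lam M) V) = eval-chain n (M [ V ])
  eval-chain (suc n) (to M N) =
    C.⊑-trans (Val 0) (>>=-mono₁ _ (eval-chain n M))
                      (>>=-mono₂ _ (λ V → eval-chain n (N [ V ])))
  eval-chain (suc n) (op σ Ms) = opT-mono σ (λ i → eval-chain n (Ms i))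

  ⟦_⟧ : Tm 0 → T (Val 0)
  ⟦ M ⟧ = C.⨆ (Val 0) (λ n → eval n M) (λ n → eval-chain n M)

  -- relators (equalities of relations are stated as mutual inclusions)
  record Relator : Set₁ where
    field
      Γ : ∀ {X Y : Set} → (X → Y → Set) → T X → T Y → Set
      Γ-refl  : ∀ {X} (u : T X) → Γ (_≡_ {A = X}) u u
      Γ-comp  : ∀ {X Y Z} (R : X → Y → Set) (S : Y → Z → Set) {u v w} →
                Γ R u v → Γ S v w → Γ (λ x z → ∃ λ y → R x y × S y z) u w
      Γ-inv⇒  : ∀ {X X' Y Y'} (f : X → X') (g : Y → Y') (R : X' → Y' → Set) u v →
                Γ (λ x y → R (f x) (g y)) u v → Γ R (Tmap f u) (Tmap g v)
      Γ-inv⇐  : ∀ {X X' Y Y'} (f : X → X') (g : Y → Y') (R : X' → Y' → Set) u v →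
                Γ R (Tmap f u) (Tmap g v) → Γ (λ x y → R (f x) (g y)) u v
      Γ-mono  : ∀ {X Y} (R S : X → Y → Set) → (∀ x y → R x y → S x y) →
                ∀ u v → Γ R u v → Γ S u v
      Γ-η     : ∀ {X Y} (R : X → Y → Set) x y → R x y → Γ R (η x) (η y)
      Γ-bind  : ∀ {X X' Y Y'} (R : X → Y → Set) (S : X' → Y' → Set)
                (f : X → T X') (g : Y → T Y') →
                (∀ x y → R x y → Γ S (f x) (g y)) →
                ∀ u v → Γ R u v → Γ S (u >>= f) (v >>= g)

  module _ (G : Relator) where
    open Relator G

    Inductive : Set₁
    Inductive =
      (∀ {X Y} (R : X → Y → Set) (v : T Y) → Γ R (C.bot X) v) ×
      (∀ {X Y} (R : X → Y → Set) (c : ℕ → T X) (p : ∀ n → c n ⊑ c (suc n)) (v : T Y) →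
         (∀ n → Γ R (c n) v) → Γ R (C.⨆ X c p) v)

    RespectsΣ : Set₁
    RespectsΣ = ∀ {X Y} (R : X → Y → Set) (σ : Op Sig)
                  (us : Fin (ar Sig σ) → T X) (vs : Fin (ar Sig σ) → T Y) →
                  (∀ i → Γ R (us i) (vs i)) → Γ R (opT σ us) (opT σ vs)

    IsSimulation : ClosedRel 0ℓ → Set
    IsSimulation R =
      (∀ M N → CT R M N → Γ (CV R) ⟦ M ⟧ ⟦ N ⟧) ×
      (∀ V W → CV R V W → ∀ U → CT R (app V U) (app W U))

    Similarity : ClosedRel (lsuc 0ℓ)
    Similarity = record
      { CT = λ M N → Σ (ClosedRel 0ℓ) (λ R → IsSimulation R × CT R M N)
      ; CV = λ V W → Σ (ClosedRel 0ℓ) (λ R → IsSimulation R × CV R V W) }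

    𝒰 : Val 0 → Val 0 → Set
    𝒰 _ _ = ⊤

    Preadequate : LamRel 0ℓ → Set
    Preadequate R = ∀ M N → RT R 0 M N → Γ 𝒰 ⟦ M ⟧ ⟦ N ⟧

    CtxPreorder : LamRel (lsuc 0ℓ)
    CtxPreorder = record
      { RT = λ n M N → Σ (LamRel 0ℓ) (λ R → Compatible R × Preadequate R × RT R n M N)
      ; RV = λ n V W → Σ (LamRel 0ℓ) (λ R → Compatible R × Preadequate R × RV R n V W) }

module Submission where

-- Applicative Γ-similarity is a precongruence contained in the Γ-contextual
-- preorder.  The proof is Howe's method.
--
-- Terms contain
-- functions (the arguments of an operation symbol), so without function
-- extensionality the substitution laws hold only up to the structural
-- equality ≈ of terms (SyntacticEquality).  And similarity is a union of
-- simulations living one universe level higher than the simulations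
-- themselves, so instead of arguing about similarity directly we argue about
-- an arbitrary set-indexed family of simulations (HoweMethod).
--
-- For such a family, the reflexive-transitive closure of its union together
-- with ≈ is again a simulation; its Howe lifting is compatible, substitutive
-- and contains its open extension, and (Howe's key lemma, using that Γ is
-- inductive and respects Σ, and the unfolding equations of ⟦_⟧ proved in
-- Denotation) its closed part is a simulation.  Finally (SimilarityFacts),
-- every premise about open similarity is witnessed by such a family, which
-- yields compatibility, the preorder laws, and — since the Howe lifting is a
-- compatible preadequate λ-term relation — soundness for ≤_Γ.

open import Defs
open import Level using (0ℓ) renaming (suc to lsuc)
open import Data.Nat using (ℕ; zero; suc; _⊔_; _≤_; z≤n; s≤s)
open import Data.Nat.Properties using (m≤m⊔n; m≤n⊔m)
open import Data.Fin using (Fin; zero; suc)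
open import Data.Product using (Σ; ∃; _×_; _,_; proj₁; proj₂)
open import Data.Sum using (inj₁; inj₂; [_,_])
open import Data.Unit using (tt)
open import Data.Empty using (⊥)
open import Function using (id; const)
open import Relation.Binary.PropositionalEquality using (_≡_; refl; cong)
open import Relation.Binary.Construct.Closure.ReflexiveTransitive
  using (Star; ε; _◅_; _◅◅_; gmap; return)

chain-mono : ∀ {D : Set} (P : ωCPPO D) (c : ℕ → D) →
             (∀ n → ωCPPO._⊑_ P (c n) (c (suc n))) →
             ∀ {m n} → m ≤ n → ωCPPO._⊑_ P (c m) (c n)
chain-mono P c step {zero} {zero} z≤n = ωCPPO.⊑-refl P
chain-mono P c step {zero} {suc n} z≤n =
  ωCPPO.⊑-trans P (chain-mono P c step {zero} {n} z≤n) (step n)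
chain-mono P c step (s≤s m≤n) =
  chain-mono P (λ n → c (suc n)) (λ n → step (suc n)) m≤n

-- Since operation symbols take functions Fin k → Tm n as arguments, the
-- usual laws (composition of substitutions, identity substitution) hold only
-- up to ≈, which compares those arguments pointwise.
module SyntacticEquality (Sig : Signature) where
  open Syntax Sig

  mutual
    data _≈V_ : ∀ {n} → Val n → Val n → Set where
      var≈ : ∀ {n} (i : Fin n) → var i ≈V var i
      lam≈ : ∀ {n} {M M' : Tm (suc n)} → M ≈T M' → lam M ≈V lam M'

    data _≈T_ : ∀ {n} → Tm n → Tm n → Set where
      ret≈ : ∀ {n} {V V' : Val n} → V ≈V V' → ret V ≈T ret V'
      app≈ : ∀ {n} {V V' W W' : Val n} → V ≈V V' → W ≈V W' → app V W ≈T app V' W'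
      to≈  : ∀ {n} {M M' : Tm n} {N N'} → M ≈T M' → N ≈T N' → to M N ≈T to M' N'
      op≈  : ∀ {n} σ {Ms Ns : Fin (ar Sig σ) → Tm n} →
             (∀ i → Ms i ≈T Ns i) → op σ Ms ≈T op σ Ns

  mutual
    ≈-reflV : ∀ {n} (V : Val n) → V ≈V V
    ≈-reflV (var i) = var≈ i
    ≈-reflV (lam M) = lam≈ (≈-reflT M)

    ≈-reflT : ∀ {n} (M : Tm n) → M ≈T M
    ≈-reflT (ret V) = ret≈ (≈-reflV V)
    ≈-reflT (app V W) = app≈ (≈-reflV V) (≈-reflV W)
    ≈-reflT (to M N) = to≈ (≈-reflT M) (≈-reflT N)
    ≈-reflT (op σ Ms) = op≈ σ (λ i → ≈-reflT (Ms i))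

  mutual
    ≈-symV : ∀ {n} {V W : Val n} → V ≈V W → W ≈V V
    ≈-symV (var≈ i) = var≈ i
    ≈-symV (lam≈ e) = lam≈ (≈-symT e)

    ≈-symT : ∀ {n} {M N : Tm n} → M ≈T N → N ≈T M
    ≈-symT (ret≈ e) = ret≈ (≈-symV e)
    ≈-symT (app≈ e f) = app≈ (≈-symV e) (≈-symV f)
    ≈-symT (to≈ e f) = to≈ (≈-symT e) (≈-symT f)
    ≈-symT (op≈ σ e) = op≈ σ (λ i → ≈-symT (e i))

  mutual
    ≈-transV : ∀ {n} {U V W : Val n} → U ≈V V → V ≈V W → U ≈V W
    ≈-transV (var≈ i) (var≈ .i) = var≈ i
    ≈-transV (lam≈ e) (lam≈ f) = lam≈ (≈-transT e f)

    ≈-transT : ∀ {n} {L M N : Tm n} → L ≈T M → M ≈T N → L ≈T N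
    ≈-transT (ret≈ e) (ret≈ f) = ret≈ (≈-transV e f)
    ≈-transT (app≈ e e') (app≈ f f') = app≈ (≈-transV e f) (≈-transV e' f')
    ≈-transT (to≈ e e') (to≈ f f') = to≈ (≈-transT e f) (≈-transT e' f')
    ≈-transT (op≈ σ e) (op≈ .σ f) = op≈ σ (λ i → ≈-transT (e i) (f i))

  var-cong : ∀ {n} {i j : Fin n} → i ≡ j → var i ≈V var j
  var-cong {i = i} refl = var≈ i

  extR-cong : ∀ {m n} {ρ ρ' : Ren m n} → (∀ i → ρ i ≡ ρ' i) → ∀ i → extR ρ i ≡ extR ρ' i
  extR-cong h zero = refl
  extR-cong h (suc i) = cong suc (h i)

  mutual
    ren-congV : ∀ {m n} {ρ ρ' : Ren m n} → (∀ i → ρ i ≡ ρ' i) →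
                ∀ {V V'} → V ≈V V' → renV ρ V ≈V renV ρ' V'
    ren-congV h (var≈ i) = var-cong (h i)
    ren-congV h (lam≈ e) = lam≈ (ren-congT (extR-cong h) e)

    ren-congT : ∀ {m n} {ρ ρ' : Ren m n} → (∀ i → ρ i ≡ ρ' i) →
                ∀ {M M'} → M ≈T M' → renT ρ M ≈T renT ρ' M'
    ren-congT h (ret≈ e) = ret≈ (ren-congV h e)
    ren-congT h (app≈ e f) = app≈ (ren-congV h e) (ren-congV h f)
    ren-congT h (to≈ e f) = to≈ (ren-congT h e) (ren-congT (extR-cong h) f)
    ren-congT h (op≈ σ e) = op≈ σ (λ i → ren-congT h (e i))

  extS-cong : ∀ {m n} {s s' : Sub m n} → (∀ i → s i ≈V s' i) → ∀ i → extS s i ≈V extS s' i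
  extS-cong h zero = var≈ zero
  extS-cong h (suc i) = ren-congV (λ _ → refl) (h i)

  mutual
    sub-congV : ∀ {m n} {s s' : Sub m n} → (∀ i → s i ≈V s' i) →
                ∀ {V V'} → V ≈V V' → subV s V ≈V subV s' V'
    sub-congV h (var≈ i) = h i
    sub-congV h (lam≈ e) = lam≈ (sub-congT (extS-cong h) e)

    sub-congT : ∀ {m n} {s s' : Sub m n} → (∀ i → s i ≈V s' i) →
                ∀ {M M'} → M ≈T M' → subT s M ≈T subT s' M'
    sub-congT h (ret≈ e) = ret≈ (sub-congV h e)
    sub-congT h (app≈ e f) = app≈ (sub-congV h e) (sub-congV h f)
    sub-congT h (to≈ e f) = to≈ (sub-congT h e) (sub-congT (extS-cong h) f)
    sub-congT h (op≈ σ e) = op≈ σ (λ i → sub-congT h (e i))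

  sub₁-cong : ∀ {n} {M M' : Tm (suc n)} {V V' : Val n} →
              M ≈T M' → V ≈V V' → (M [ V ]) ≈T (M' [ V' ])
  sub₁-cong e f = sub-congT (λ { zero → f ; (suc i) → var≈ i }) e

  -- Each is stated for a prescribed composite (ρ'' or s' or u) so that the
  -- statement is closed under going under a binder.

  extR-comp : ∀ {k m n} {ρ : Ren m n} {ρ' : Ren k m} {ρ'' : Ren k n} →
              (∀ i → ρ (ρ' i) ≡ ρ'' i) → ∀ i → extR ρ (extR ρ' i) ≡ extR ρ'' i
  extR-comp h zero = refl
  extR-comp h (suc i) = cong suc (h i)

  mutual
    ren-renV : ∀ {k m n} {ρ : Ren m n} {ρ' : Ren k m} {ρ'' : Ren k n} →
               (∀ i → ρ (ρ' i) ≡ ρ'' i) → ∀ V → renV ρ (renV ρ' V) ≈V renV ρ'' V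
    ren-renV h (var i) = var-cong (h i)
    ren-renV h (lam M) = lam≈ (ren-renT (extR-comp h) M)

    ren-renT : ∀ {k m n} {ρ : Ren m n} {ρ' : Ren k m} {ρ'' : Ren k n} →
               (∀ i → ρ (ρ' i) ≡ ρ'' i) → ∀ M → renT ρ (renT ρ' M) ≈T renT ρ'' M
    ren-renT h (ret V) = ret≈ (ren-renV h V)
    ren-renT h (app V W) = app≈ (ren-renV h V) (ren-renV h W)
    ren-renT h (to M N) = to≈ (ren-renT h M) (ren-renT (extR-comp h) N)
    ren-renT h (op σ Ms) = op≈ σ (λ i → ren-renT h (Ms i))

  extSR-comp : ∀ {k m n} {s : Sub m n} {ρ : Ren k m} {s' : Sub k n} →
               (∀ i → s (ρ i) ≈V s' i) → ∀ i → extS s (extR ρ i) ≈V extS s' i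
  extSR-comp h zero = var≈ zero
  extSR-comp h (suc i) = ren-congV (λ _ → refl) (h i)

  mutual
    sub-renV : ∀ {k m n} {s : Sub m n} {ρ : Ren k m} {s' : Sub k n} →
               (∀ i → s (ρ i) ≈V s' i) → ∀ V → subV s (renV ρ V) ≈V subV s' V
    sub-renV h (var i) = h i
    sub-renV h (lam M) = lam≈ (sub-renT (extSR-comp h) M)

    sub-renT : ∀ {k m n} {s : Sub m n} {ρ : Ren k m} {s' : Sub k n} →
               (∀ i → s (ρ i) ≈V s' i) → ∀ M → subT s (renT ρ M) ≈T subT s' M
    sub-renT h (ret V) = ret≈ (sub-renV h V)
    sub-renT h (app V W) = app≈ (sub-renV h V) (sub-renV h W)
    sub-renT h (to M N) = to≈ (sub-renT h M) (sub-renT (extSR-comp h) N)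
    sub-renT h (op σ Ms) = op≈ σ (λ i → sub-renT h (Ms i))

  extRS-comp : ∀ {k m n} {ρ : Ren m n} {s : Sub k m} {s' : Sub k n} →
               (∀ i → renV ρ (s i) ≈V s' i) → ∀ i → renV (extR ρ) (extS s i) ≈V extS s' i
  extRS-comp h zero = var≈ zero
  extRS-comp {ρ = ρ} {s} h (suc i) =
    ≈-transV (ren-renV {ρ'' = λ j → suc (ρ j)} (λ _ → refl) (s i))
      (≈-transV (≈-symV (ren-renV (λ _ → refl) (s i)))
                (ren-congV (λ _ → refl) (h i)))

  mutual
    ren-subV : ∀ {k m n} {ρ : Ren m n} {s : Sub k m} {s' : Sub k n} →
               (∀ i → renV ρ (s i) ≈V s' i) → ∀ V → renV ρ (subV s V) ≈V subV s' V
    ren-subV h (var i) = h i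
    ren-subV h (lam M) = lam≈ (ren-subT (extRS-comp h) M)

    ren-subT : ∀ {k m n} {ρ : Ren m n} {s : Sub k m} {s' : Sub k n} →
               (∀ i → renV ρ (s i) ≈V s' i) → ∀ M → renT ρ (subT s M) ≈T subT s' M
    ren-subT h (ret V) = ret≈ (ren-subV h V)
    ren-subT h (app V W) = app≈ (ren-subV h V) (ren-subV h W)
    ren-subT h (to M N) = to≈ (ren-subT h M) (ren-subT (extRS-comp h) N)
    ren-subT h (op σ Ms) = op≈ σ (λ i → ren-subT h (Ms i))

  extSS-comp : ∀ {k m n} {t : Sub m n} {s : Sub k m} {u : Sub k n} →
               (∀ i → subV t (s i) ≈V u i) → ∀ i → subV (extS t) (extS s i) ≈V extS u i
  extSS-comp h zero = var≈ zero
  extSS-comp {t = t} {s} h (suc i) =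
    ≈-transV (sub-renV {s' = λ j → renV suc (t j)} (λ _ → ≈-reflV _) (s i))
      (≈-transV (≈-symV (ren-subV (λ _ → ≈-reflV _) (s i)))
                (ren-congV (λ _ → refl) (h i)))

  mutual
    sub-subV : ∀ {k m n} {t : Sub m n} {s : Sub k m} {u : Sub k n} →
               (∀ i → subV t (s i) ≈V u i) → ∀ V → subV t (subV s V) ≈V subV u V
    sub-subV h (var i) = h i
    sub-subV h (lam M) = lam≈ (sub-subT (extSS-comp h) M)

    sub-subT : ∀ {k m n} {t : Sub m n} {s : Sub k m} {u : Sub k n} →
               (∀ i → subV t (s i) ≈V u i) → ∀ M → subT t (subT s M) ≈T subT u M
    sub-subT h (ret V) = ret≈ (sub-subV h V)
    sub-subT h (app V W) = app≈ (sub-subV h V) (sub-subV h W)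
    sub-subT h (to M N) = to≈ (sub-subT h M) (sub-subT (extSS-comp h) N)
    sub-subT h (op σ Ms) = op≈ σ (λ i → sub-subT h (Ms i))

  extS-id : ∀ {n} {s : Sub n n} → (∀ i → s i ≈V var i) → ∀ i → extS s i ≈V var i
  extS-id h zero = var≈ zero
  extS-id h (suc i) = ren-congV (λ _ → refl) (h i)

  mutual
    sub-idV : ∀ {n} {s : Sub n n} → (∀ i → s i ≈V var i) → ∀ V → subV s V ≈V V
    sub-idV h (var i) = h i
    sub-idV h (lam M) = lam≈ (sub-idT (extS-id h) M)

    sub-idT : ∀ {n} {s : Sub n n} → (∀ i → s i ≈V var i) → ∀ M → subT s M ≈T M
    sub-idT h (ret V) = ret≈ (sub-idV h V)
    sub-idT h (app V W) = app≈ (sub-idV h V) (sub-idV h W)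
    sub-idT h (to M N) = to≈ (sub-idT h M) (sub-idT (extS-id h) N)
    sub-idT h (op σ Ms) = op≈ σ (λ i → sub-idT h (Ms i))

  closed-subT : ∀ (s : Sub 0 0) M → subT s M ≈T M
  closed-subT s = sub-idT (λ ())

  closed-subV : ∀ (s : Sub 0 0) V → subV s V ≈V V
  closed-subV s = sub-idV (λ ())

-- The inequalities ⊒ use the continuity of bind
-- and of the operations.
module Denotation {Sig : Signature} (A : ContAlg Sig) where
  open Syntax Sig
  open ContAlg A
  open Semantics A
  private module D = ωCPPO (cppo (Val 0))

  eval⊑⟦⟧ : ∀ n M → eval n M ⊑ ⟦ M ⟧
  eval⊑⟦⟧ n M = D.⨆-ub _ _ n

  ⟦⟧-least : ∀ M {u} → (∀ n → eval n M ⊑ u) → ⟦ M ⟧ ⊑ u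
  ⟦⟧-least M = D.⨆-least _ _

  eval-mono : ∀ M {m n} → m ≤ n → eval m M ⊑ eval n M
  eval-mono M = chain-mono (cppo (Val 0)) (λ n → eval n M) (λ n → eval-chain n M)

  ⟦ret⟧ : ∀ V → ⟦ ret V ⟧ ≡ η V
  ⟦ret⟧ V = D.⊑-antisym (⟦⟧-least (ret V) below) (eval⊑⟦⟧ 1 (ret V))
    where
      below : ∀ n → eval n (ret V) ⊑ η V
      below zero = D.bot-least
      below (suc n) = D.⊑-refl

  ⟦app⟧ : ∀ M V → ⟦ app (lam M) V ⟧ ≡ ⟦ M [ V ] ⟧
  ⟦app⟧ M V = D.⊑-antisym (⟦⟧-least (app (lam M) V) below)
                          (⟦⟧-least (M [ V ]) (λ n → eval⊑⟦⟧ (suc n) (app (lam M) V)))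
    where
      below : ∀ n → eval n (app (lam M) V) ⊑ ⟦ M [ V ] ⟧
      below zero = D.bot-least
      below (suc n) = eval⊑⟦⟧ n (M [ V ])

  ⟦to⟧ : ∀ M K → ⟦ to M K ⟧ ≡ (⟦ M ⟧ >>= λ V → ⟦ K [ V ] ⟧)
  ⟦to⟧ M K =
    D.⊑-antisym (⟦⟧-least (to M K) below)
      (>>=-lub₁ _ _ _ _ λ m →
         >>=-lub₂ _ (λ n V → eval n (K [ V ])) (λ n V → eval-chain n (K [ V ])) _
           (approximant m))
    where
      below : ∀ n → eval n (to M K) ⊑ (⟦ M ⟧ >>= λ V → ⟦ K [ V ] ⟧)
      below zero = D.bot-least
      below (suc n) = D.⊑-trans (>>=-mono₁ _ (eval⊑⟦⟧ n M))
                                (>>=-mono₂ _ (λ V → eval⊑⟦⟧ n (K [ V ])))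
      -- eval m M >>= eval n ∘ K[-] is below the (1 + m ⊔ n)-th approximation.
      approximant : ∀ m n → (eval m M >>= λ V → eval n (K [ V ])) ⊑ ⟦ to M K ⟧
      approximant m n =
        D.⊑-trans (>>=-mono₁ _ (eval-mono M (m≤m⊔n m n)))
          (D.⊑-trans (>>=-mono₂ _ (λ V → eval-mono (K [ V ]) (m≤n⊔m m n)))
                     (eval⊑⟦⟧ (suc (m ⊔ n)) (to M K)))

  ⟦op⟧ : ∀ σ Ms → ⟦ op σ Ms ⟧ ≡ opT σ (λ i → ⟦ Ms i ⟧)
  ⟦op⟧ σ Ms =
    D.⊑-antisym (⟦⟧-least (op σ Ms) below)
      (opT-lub σ (λ n i → eval n (Ms i)) (λ n i → eval-chain n (Ms i)) _
         (λ n → eval⊑⟦⟧ (suc n) (op σ Ms)))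
    where
      below : ∀ n → eval n (op σ Ms) ⊑ opT σ (λ i → ⟦ Ms i ⟧)
      below zero = D.bot-least
      below (suc n) = opT-mono σ (λ i → eval⊑⟦⟧ n (Ms i))

module HoweMethod (Sig : Signature) (A : ContAlg Sig) (G : Semantics.Relator A)
            (ind : Semantics.Inductive A G) (resp : Semantics.RespectsΣ A G) where
  open Syntax Sig
  open SyntacticEquality Sig
  open ContAlg A
  open Semantics A
  open Relator G
  open Denotation A

  Γ-eval₀ : ∀ (R : Val 0 → Val 0 → Set) M v → Γ R (eval 0 M) v
  Γ-eval₀ R M v = proj₁ ind R v

  Γ-⟦⟧ : ∀ (R : Val 0 → Val 0 → Set) M v → (∀ k → Γ R (eval k M) v) → Γ R ⟦ M ⟧ v
  Γ-⟦⟧ R M v = proj₂ ind R _ _ v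

  Γ-respʳ : ∀ {R : Val 0 → Val 0 → Set} {u v v'} → v ≡ v' → Γ R u v' → Γ R u v
  Γ-respʳ refl g = g

  -- Structurally equal closed terms have Γ(≈)-related denotations; this
  -- is the one place where ≈ meets the semantics.
  ≈-approx : ∀ k {M M' : Tm 0} → M ≈T M' → Γ _≈V_ (eval k M) ⟦ M' ⟧
  ≈-approx zero {M} e = Γ-eval₀ _ M _
  ≈-approx (suc k) (ret≈ {V' = V'} e) = Γ-respʳ (⟦ret⟧ V') (Γ-η _ _ _ e)
  ≈-approx (suc k) (app≈ (var≈ ()) f)
  ≈-approx (suc k) (app≈ {W' = W'} (lam≈ {M' = M'} e) f) =
    Γ-respʳ (⟦app⟧ M' W') (≈-approx k (sub₁-cong e f))
  ≈-approx (suc k) (to≈ {M' = M'} {N' = K'} e f) =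
    Γ-respʳ (⟦to⟧ M' K')
      (Γ-bind _ _ _ _ (λ V W V≈W → ≈-approx k (sub₁-cong f V≈W)) _ _ (≈-approx k e))
  ≈-approx (suc k) (op≈ σ {Ns = Ns} e) =
    Γ-respʳ (⟦op⟧ σ Ns) (resp _ σ _ _ (λ i → ≈-approx k (e i)))

  ≈-sim : ∀ {M M' : Tm 0} → M ≈T M' → Γ _≈V_ ⟦ M ⟧ ⟦ M' ⟧
  ≈-sim {M} e = Γ-⟦⟧ _ M _ (λ k → ≈-approx k e)

  Witness : Set₁
  Witness = Σ (ClosedRel 0ℓ) (IsSimulation G)

  module Lifting {I : Set} (family : I → Witness) where

    rel : I → ClosedRel 0ℓ
    rel i = proj₁ (family i)

    data StepT : Tm 0 → Tm 0 → Set where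
      ≈-stepT : ∀ {M N} → M ≈T N → StepT M N
      rel-stepT : ∀ {M N} (i : I) → CT (rel i) M N → StepT M N

    data StepV : Val 0 → Val 0 → Set where
      ≈-stepV : ∀ {V W} → V ≈V W → StepV V W
      rel-stepV : ∀ {V W} (i : I) → CV (rel i) V W → StepV V W

    CloT : Tm 0 → Tm 0 → Set
    CloT = Star StepT

    CloV : Val 0 → Val 0 → Set
    CloV = Star StepV

    Clo : ClosedRel 0ℓ
    Clo = record { CT = CloT ; CV = CloV }

    stepT-sim : ∀ {M N} → StepT M N → Γ CloV ⟦ M ⟧ ⟦ N ⟧
    stepT-sim (≈-stepT e) = Γ-mono _≈V_ CloV (λ _ _ e → return (≈-stepV e)) _ _ (≈-sim e)
    stepT-sim (rel-stepT i r) =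
      Γ-mono (CV (rel i)) CloV (λ _ _ r → return (rel-stepV i r)) _ _
        (proj₁ (proj₂ (family i)) _ _ r)

    -- Γ preserves composition, so the closure is a simulation on terms ...
    cloT-sim : ∀ {M N} → CloT M N → Γ CloV ⟦ M ⟧ ⟦ N ⟧
    cloT-sim ε = Γ-mono _≡_ CloV (λ _ _ → λ { refl → ε }) _ _ (Γ-refl _)
    cloT-sim (st ◅ rest) =
      Γ-mono (λ x z → ∃ λ y → CloV x y × CloV y z) CloV (λ { _ _ (_ , p , q) → p ◅◅ q }) _ _
        (Γ-comp CloV CloV (stepT-sim st) (cloT-sim rest))

    -- ... and on values, since application preserves each step.
    cloV-app : ∀ {V W} → CloV V W → ∀ U → CloT (app V U) (app W U)
    cloV-app p U = gmap (λ V → app V U) step p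
      where
        step : ∀ {V W} → StepV V W → StepT (app V U) (app W U)
        step (≈-stepV e) = ≈-stepT (app≈ e (≈-reflV U))
        step (rel-stepV i r) = rel-stepT i (proj₂ (proj₂ (family i)) _ _ r U)

    clo-isSimulation : IsSimulation G Clo
    clo-isSimulation = (λ _ _ → cloT-sim) , (λ _ _ → cloV-app)

    -- The open extension of the closure, packed in records so that the
    -- terms stay visible to unification.
    record OpenT (n : ℕ) (M N : Tm n) : Set where
      constructor openT
      field atT : (s : Sub n 0) → CloT (subT s M) (subT s N)
    open OpenT public

    record OpenV (n : ℕ) (V W : Val n) : Set where
      constructor openV
      field atV : (s : Sub n 0) → CloV (subV s V) (subV s W)
    open OpenV public

    Open-reflT : ∀ {n} (M : Tm n) → OpenT n M M
    Open-reflT M = openT λ _ → ε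

    Open-reflV : ∀ {n} (V : Val n) → OpenV n V V
    Open-reflV V = openV λ _ → ε

    Open-transT : ∀ {n} {L M N : Tm n} → OpenT n L M → OpenT n M N → OpenT n L N
    Open-transT p q = openT λ s → atT p s ◅◅ atT q s

    Open-transV : ∀ {n} {U V W : Val n} → OpenV n U V → OpenV n V W → OpenV n U W
    Open-transV p q = openV λ s → atV p s ◅◅ atV q s

    -- The open extension is closed under substitution and renaming: an
    -- instance of an instance is an instance, up to ≈.
    Open-subT : ∀ {n m} {M N : Tm n} → OpenT n M N → (s : Sub n m) →
                OpenT m (subT s M) (subT s N)
    Open-subT {M = M} {N} p s = openT λ t →
      ≈-stepT (sub-subT (λ _ → ≈-reflV _) M) ◅ atT p (λ i → subV t (s i)) ◅◅
      return (≈-stepT (≈-symT (sub-subT (λ _ → ≈-reflV _) N)))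

    Open-subV : ∀ {n m} {V W : Val n} → OpenV n V W → (s : Sub n m) →
                OpenV m (subV s V) (subV s W)
    Open-subV {V = V} {W} p s = openV λ t →
      ≈-stepV (sub-subV (λ _ → ≈-reflV _) V) ◅ atV p (λ i → subV t (s i)) ◅◅
      return (≈-stepV (≈-symV (sub-subV (λ _ → ≈-reflV _) W)))

    Open-renT : ∀ {n m} {M N : Tm n} → OpenT n M N → (ρ : Ren n m) →
                OpenT m (renT ρ M) (renT ρ N)
    Open-renT {M = M} {N} p ρ = openT λ t →
      ≈-stepT (sub-renT (λ _ → ≈-reflV _) M) ◅ atT p (λ i → t (ρ i)) ◅◅
      return (≈-stepT (≈-symT (sub-renT (λ _ → ≈-reflV _) N)))

    Open-renV : ∀ {n m} {V W : Val n} → OpenV n V W → (ρ : Ren n m) →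
                OpenV m (renV ρ V) (renV ρ W)
    Open-renV {V = V} {W} p ρ = openV λ t →
      ≈-stepV (sub-renV (λ _ → ≈-reflV _) V) ◅ atV p (λ i → t (ρ i)) ◅◅
      return (≈-stepV (≈-symV (sub-renV (λ _ → ≈-reflV _) W)))

    open⇒closedT : ∀ {M N} → OpenT 0 M N → CloT M N
    open⇒closedT {M} {N} p =
      ≈-stepT (≈-symT (closed-subT (λ ()) M)) ◅ atT p (λ ()) ◅◅
      return (≈-stepT (closed-subT (λ ()) N))

    open⇒closedV : ∀ {V W} → OpenV 0 V W → CloV V W
    open⇒closedV {V} {W} p =
      ≈-stepV (≈-symV (closed-subV (λ ()) V)) ◅ atV p (λ ()) ◅◅
      return (≈-stepV (closed-subV (λ ()) W))

    closed⇒openV : ∀ {V W} → CloV V W → OpenV 0 V W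
    closed⇒openV {V} {W} p = openV λ s →
      ≈-stepV (closed-subV s V) ◅ p ◅◅ return (≈-stepV (≈-symV (closed-subV s W)))

    -- Howe's lifting: the compatible refinement of itself, followed by one
    -- step of the open extension.
    mutual
      data HoweV : ∀ {n} → Val n → Val n → Set where
        hvar : ∀ {n} {i : Fin n} {W} → OpenV n (var i) W → HoweV (var i) W
        hlam : ∀ {n} {M M' : Tm (suc n)} {W} →
               HoweT M M' → OpenV n (lam M') W → HoweV (lam M) W

      data HoweT : ∀ {n} → Tm n → Tm n → Set where
        hret : ∀ {n} {V V' : Val n} {N} →
               HoweV V V' → OpenT n (ret V') N → HoweT (ret V) N
        happ : ∀ {n} {V V' W W' : Val n} {N} →
               HoweV V V' → HoweV W W' → OpenT n (app V' W') N → HoweT (app V W) N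
        hto  : ∀ {n} {M M' : Tm n} {K K'} {N} →
               HoweT M M' → HoweT K K' → OpenT n (to M' K') N → HoweT (to M K) N
        hop  : ∀ {n} σ {Ms Ms' : Fin (ar Sig σ) → Tm n} {N} →
               (∀ i → HoweT (Ms i) (Ms' i)) → OpenT n (op σ Ms') N → HoweT (op σ Ms) N

    mutual
      howe-reflV : ∀ {n} (V : Val n) → HoweV V V
      howe-reflV (var i) = hvar (Open-reflV _)
      howe-reflV (lam M) = hlam (howe-reflT M) (Open-reflV _)

      howe-reflT : ∀ {n} (M : Tm n) → HoweT M M
      howe-reflT (ret V) = hret (howe-reflV V) (Open-reflT _)
      howe-reflT (app V W) = happ (howe-reflV V) (howe-reflV W) (Open-reflT _)
      howe-reflT (to M N) = hto (howe-reflT M) (howe-reflT N) (Open-reflT _)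
      howe-reflT (op σ Ms) = hop σ (λ i → howe-reflT (Ms i)) (Open-reflT _)

    howe-postV : ∀ {n} {U V W : Val n} → HoweV U V → OpenV n V W → HoweV U W
    howe-postV (hvar p) q = hvar (Open-transV p q)
    howe-postV (hlam h p) q = hlam h (Open-transV p q)

    howe-postT : ∀ {n} {L M N : Tm n} → HoweT L M → OpenT n M N → HoweT L N
    howe-postT (hret h p) q = hret h (Open-transT p q)
    howe-postT (happ h h' p) q = happ h h' (Open-transT p q)
    howe-postT (hto h h' p) q = hto h h' (Open-transT p q)
    howe-postT (hop σ h p) q = hop σ h (Open-transT p q)

    open⊆howeT : ∀ {n} {M N : Tm n} → OpenT n M N → HoweT M N
    open⊆howeT = howe-postT (howe-reflT _)

    open⊆howeV : ∀ {n} {V W : Val n} → OpenV n V W → HoweV V W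
    open⊆howeV = howe-postV (howe-reflV _)

    mutual
      howe-renV : ∀ {n m} {V W : Val n} → HoweV V W → (ρ : Ren n m) →
                  HoweV (renV ρ V) (renV ρ W)
      howe-renV (hvar p) ρ = hvar (Open-renV p ρ)
      howe-renV (hlam h p) ρ = hlam (howe-renT h (extR ρ)) (Open-renV p ρ)

      howe-renT : ∀ {n m} {M N : Tm n} → HoweT M N → (ρ : Ren n m) →
                  HoweT (renT ρ M) (renT ρ N)
      howe-renT (hret h p) ρ = hret (howe-renV h ρ) (Open-renT p ρ)
      howe-renT (happ h h' p) ρ = happ (howe-renV h ρ) (howe-renV h' ρ) (Open-renT p ρ)
      howe-renT (hto h h' p) ρ = hto (howe-renT h ρ) (howe-renT h' (extR ρ)) (Open-renT p ρ)
      howe-renT (hop σ h p) ρ = hop σ (λ i → howe-renT (h i) ρ) (Open-renT p ρ)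

    howe-extS : ∀ {n m} {s s' : Sub n m} → (∀ i → HoweV (s i) (s' i)) →
                ∀ i → HoweV (extS s i) (extS s' i)
    howe-extS h zero = howe-reflV _
    howe-extS h (suc i) = howe-renV (h i) suc

    -- Howe's substitution lemma: related substitutions instantiate related
    -- terms to related terms.  The variable case is where post-composition
    -- with the open extension is needed.
    mutual
      howe-subV : ∀ {n m} {V W : Val n} → HoweV V W → (s s' : Sub n m) →
                  (∀ i → HoweV (s i) (s' i)) → HoweV (subV s V) (subV s' W)
      howe-subV (hvar {i = i} p) s s' hs = howe-postV (hs i) (Open-subV p s')
      howe-subV (hlam h p) s s' hs =
        hlam (howe-subT h (extS s) (extS s') (howe-extS hs)) (Open-subV p s')

      howe-subT : ∀ {n m} {M N : Tm n} → HoweT M N → (s s' : Sub n m) →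
                  (∀ i → HoweV (s i) (s' i)) → HoweT (subT s M) (subT s' N)
      howe-subT (hret h p) s s' hs = hret (howe-subV h s s' hs) (Open-subT p s')
      howe-subT (happ h h' p) s s' hs =
        happ (howe-subV h s s' hs) (howe-subV h' s s' hs) (Open-subT p s')
      howe-subT (hto h h' p) s s' hs =
        hto (howe-subT h s s' hs) (howe-subT h' (extS s) (extS s') (howe-extS hs))
            (Open-subT p s')
      howe-subT (hop σ h p) s s' hs = hop σ (λ i → howe-subT (h i) s s' hs) (Open-subT p s')

    howe-β : ∀ {n} {M M' : Tm (suc n)} {V V' : Val n} →
             HoweT M M' → HoweV V V' → HoweT (M [ V ]) (M' [ V' ])
    howe-β h hv = howe-subT h _ _ λ { zero → hv ; (suc i) → howe-reflV (var i) }

    howe-instT : ∀ {n} {M N : Tm n} → HoweT M N → (s : Sub n 0) → HoweT (subT s M) (subT s N)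
    howe-instT h s = howe-subT h s s (λ i → howe-reflV (s i))

    howe-instV : ∀ {n} {V W : Val n} → HoweV V W → (s : Sub n 0) → HoweV (subV s V) (subV s W)
    howe-instV h s = howe-subV h s s (λ i → howe-reflV (s i))

    -- Each approximation eval k M is Γ-related to ⟦N⟧,
    -- by induction on k: the lifting's compatible part is handled by the
    -- unit, bind and Σ-laws of Γ, and its trailing open step by the fact
    -- that the closure is a simulation (Γ-comp).
    Γ-howe-post : ∀ {u L N} → Γ HoweV u ⟦ L ⟧ → CloT L N → Γ HoweV u ⟦ N ⟧
    Γ-howe-post g p =
      Γ-mono (λ x z → ∃ λ y → HoweV x y × CloV y z) HoweV
        (λ { _ _ (_ , h , q) → howe-postV h (closed⇒openV q) }) _ _
        (Γ-comp HoweV CloV g (cloT-sim p))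

    howe-approx : ∀ k {M N : Tm 0} → HoweT M N → Γ HoweV (eval k M) ⟦ N ⟧
    howe-approx zero {M} h = Γ-eval₀ _ M _
    howe-approx (suc k) (hret {V' = V'} hv p) =
      Γ-howe-post (Γ-respʳ (⟦ret⟧ V') (Γ-η _ _ _ hv)) (open⇒closedT p)
    howe-approx (suc k) (happ (hvar {i = ()} _) hw p)
    howe-approx (suc k) (happ (hlam {M' = M'} hm q) hw p) =
      Γ-howe-post (Γ-respʳ (⟦app⟧ M' _) (howe-approx k (howe-β hm hw)))
        (cloV-app (open⇒closedV q) _ ◅◅ open⇒closedT p)
    howe-approx (suc k) (hto {M' = M'} {K' = K'} hm hk p) =
      Γ-howe-post
        (Γ-respʳ (⟦to⟧ M' K')
          (Γ-bind _ _ _ _ (λ _ _ hv → howe-approx k (howe-β hk hv)) _ _ (howe-approx k hm)))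
        (open⇒closedT p)
    howe-approx (suc k) (hop σ {Ms' = Ms'} h p) =
      Γ-howe-post (Γ-respʳ (⟦op⟧ σ Ms') (resp _ σ _ _ (λ i → howe-approx k (h i))))
        (open⇒closedT p)

    HoweClosed : ClosedRel 0ℓ
    HoweClosed = record { CT = HoweT {0} ; CV = HoweV {0} }

    howe-isSimulation : IsSimulation G HoweClosed
    howe-isSimulation =
      (λ M N h → Γ-⟦⟧ _ M _ (λ k → howe-approx k h)) ,
      (λ V W h U → happ h (howe-reflV U) (Open-reflT _))

    HoweLam : LamRel 0ℓ
    HoweLam = record { RT = λ n → HoweT {n} ; RV = λ n → HoweV {n} }

    howe-compatible : Compatible HoweLam
    howe-compatible = record
      { c-var = λ n i → howe-reflV (var i)
      ; c-lam = λ n M N h → hlam h (Open-reflV _)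
      ; c-ret = λ n V W h → hret h (Open-reflT _)
      ; c-app = λ n V V' W W' h h' → happ h h' (Open-reflT _)
      ; c-to = λ n M M' N N' h h' → hto h h' (Open-reflT _)
      ; c-op = λ n σ Ms Ns h → hop σ h (Open-reflT _)
      }

    howe-preadequate : Preadequate G HoweLam
    howe-preadequate M N h =
      Γ-mono HoweV (𝒰 G) (λ _ _ _ → tt) _ _ (proj₁ howe-isSimulation M N h)

-- Each statement about open
-- similarity is reduced to one about the closure or the Howe lifting of a
-- family collecting the simulations that witness its premises.
module SimilarityFacts (Sig : Signature) (A : ContAlg Sig) (G : Semantics.Relator A)
                       (ind : Semantics.Inductive A G) (resp : Semantics.RespectsΣ A G) where
  open Syntax Sig
  open Semantics A
  open HoweMethod Sig A G ind resp
  open Lifting using (HoweT; HoweV; rel-stepT; rel-stepV; Clo; clo-isSimulation;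
                      HoweLam; howe-compatible; howe-preadequate)

  Sim° : LamRel (lsuc 0ℓ)
  Sim° = OpenExt (Similarity G)

  witnesses : ∀ {n} {P : Sub n 0 → ClosedRel 0ℓ → Set} →
              ((s : Sub n 0) → Σ (ClosedRel 0ℓ) (λ R → IsSimulation G R × P s R)) →
              Sub n 0 → Witness
  witnesses p s = proj₁ (p s) , proj₁ (proj₂ (p s))

  relatedT : ∀ {n} (M N : Tm n) (p : RT Sim° n M N) (s : Sub n 0) →
             CT (proj₁ (p s)) (subT s M) (subT s N)
  relatedT M N p s = proj₂ (proj₂ (p s))

  relatedV : ∀ {n} (V W : Val n) (p : RV Sim° n V W) (s : Sub n 0) →
             CV (proj₁ (p s)) (subV s V) (subV s W)
  relatedV V W p s = proj₂ (proj₂ (p s))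

  instances⇒howeT : ∀ {I} (F : I → Witness) {n} {M N : Tm n} (f : Sub n 0 → I) →
                    (∀ s → CT (proj₁ (F (f s))) (subT s M) (subT s N)) → HoweT F M N
  instances⇒howeT F f h = Lifting.open⊆howeT F (Lifting.openT λ s → return (rel-stepT (f s) (h s)))

  instances⇒howeV : ∀ {I} (F : I → Witness) {n} {V W : Val n} (f : Sub n 0 → I) →
                    (∀ s → CV (proj₁ (F (f s))) (subV s V) (subV s W)) → HoweV F V W
  instances⇒howeV F f h = Lifting.open⊆howeV F (Lifting.openV λ s → return (rel-stepV (f s) (h s)))

  -- Conversely, Howe pairs are openly similar: the closed Howe lifting is a
  -- simulation and the lifting is substitutive.
  howe⇒simT : ∀ {I} (F : I → Witness) {n} {M N : Tm n} → HoweT F M N → RT Sim° n M N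
  howe⇒simT F h s = Lifting.HoweClosed F , Lifting.howe-isSimulation F , Lifting.howe-instT F h s

  howe⇒simV : ∀ {I} (F : I → Witness) {n} {V W : Val n} → HoweV F V W → RV Sim° n V W
  howe⇒simV F h s = Lifting.HoweClosed F , Lifting.howe-isSimulation F , Lifting.howe-instV F h s

  -- Reflexivity and transitivity: the closure of the empty family, resp. of
  -- the two witnesses of the premises, relates the pair.
  noWitness : ⊥ → Witness
  noWitness ()

  preorder : Preorder Sim°
  preorder = record
    { reflT = λ n M s → Clo noWitness , clo-isSimulation noWitness , ε
    ; reflV = λ n V s → Clo noWitness , clo-isSimulation noWitness , ε
    ; transT = λ n L M N p q s →
        let F = [ const (witnesses p s) , const (witnesses q s) ] in
        Clo F , clo-isSimulation F ,
        (rel-stepT (inj₁ tt) (relatedT L M p s) ◅ return (rel-stepT (inj₂ tt) (relatedT M N q s)))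
    ; transV = λ n U V W p q s →
        let F = [ const (witnesses p s) , const (witnesses q s) ] in
        Clo F , clo-isSimulation F ,
        (rel-stepV (inj₁ tt) (relatedV U V p s) ◅ return (rel-stepV (inj₂ tt) (relatedV V W q s)))
    }

  -- Compatibility: each rule is the corresponding rule of the Howe lifting
  -- of the family of witnesses of its premises.
  compatible : Compatible Sim°
  compatible = record
    { c-var = λ n i → Preorder.reflV preorder n (var i)
    ; c-lam = λ n M N p → let F = witnesses p in
        howe⇒simV F (Compatible.c-lam (howe-compatible F) n M N (instances⇒howeT F id (relatedT M N p)))
    ; c-ret = λ n V W p → let F = witnesses p in
        howe⇒simT F (Compatible.c-ret (howe-compatible F) n V W (instances⇒howeV F id (relatedV V W p)))
    ; c-app = λ n V V' W W' p q → let F = [ witnesses p , witnesses q ] in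
        howe⇒simT F (Compatible.c-app (howe-compatible F) n V V' W W'
          (instances⇒howeV F inj₁ (relatedV V V' p)) (instances⇒howeV F inj₂ (relatedV W W' q)))
    ; c-to = λ n M M' N N' p q → let F = [ witnesses p , witnesses q ] in
        howe⇒simT F (Compatible.c-to (howe-compatible F) n M M' N N'
          (instances⇒howeT F inj₁ (relatedT M M' p)) (instances⇒howeT F inj₂ (relatedT N N' q)))
    ; c-op = λ n σ Ms Ns p → let F = λ (is : Σ (Fin (ar Sig σ)) (λ _ → Sub n 0)) →
                                       witnesses (p (proj₁ is)) (proj₂ is) in
        howe⇒simT F (Compatible.c-op (howe-compatible F) n σ Ms Ns
          (λ i → instances⇒howeT F (i ,_) (relatedT (Ms i) (Ns i) (p i))))
    }

  -- Soundness: an openly similar pair lies in the Howe lifting of its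
  -- witnesses, a compatible preadequate λ-term relation.
  soundT : ∀ n M N → RT Sim° n M N → RT (CtxPreorder G) n M N
  soundT n M N p = let F = witnesses p in
    HoweLam F , howe-compatible F , howe-preadequate F , instances⇒howeT F id (relatedT M N p)

  soundV : ∀ n V W → RV Sim° n V W → RV (CtxPreorder G) n V W
  soundV n V W p = let F = witnesses p in
    HoweLam F , howe-compatible F , howe-preadequate F , instances⇒howeV F id (relatedV V W p)

mainTheorem1 : (Sig : Signature) (A : ContAlg Sig) (G : Semantics.Relator A) →
    Semantics.Inductive A G → Semantics.RespectsΣ A G →
    Syntax.Precongruence Sig (Syntax.OpenExt Sig (Semantics.Similarity A G)) ×
    ((∀ n M N → Syntax.RT (Syntax.OpenExt Sig (Semantics.Similarity A G)) n M N →
        Syntax.RT (Semantics.CtxPreorder A G) n M N) ×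
     (∀ n V W → Syntax.RV (Syntax.OpenExt Sig (Semantics.Similarity A G)) n V W →
        Syntax.RV (Semantics.CtxPreorder A G) n V W))
mainTheorem1 Sig A G ind resp = (compatible , preorder) , soundT , soundV
  where open SimilarityFacts Sig A G ind resp
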